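{- Let $H$ be a $(0,1,2)$-multigraph of order $n\ge 3$ with exactly two distinct main eigenvalues whose $B$-graph is the cycle $C_n$, and let $a,b$ be integers such that $a\,d(v)+b=s(v)$ for every $v\in V(H)$. Label the vertices as follows: if $n$ is even, $V(H)=\{u_1,\dots,u_{n/2},v_1,\dots,v_{n/2}\}$ with $u_1u_2\cdots u_{n/2}v_{n/2}\cdots v_2v_1u_1$ the cycle of the $B$-graph; if $n$ is odd, $V(H)=\{u_1,\dots,u_{(n-1)/2},v_1,\dots,v_{(n-1)/2},x\}$ with $u_1\cdots u_{(n-1)/2}\,x\,v_{(n-1)/2}\cdots v_1u_1$ the cycle; and assume $w(u_1,v_1)=2$. If $w(u_1,u_2)=1$ and $w(v_1,v_2)=1$, then $H$ is isomorphic to $U^1_{4t}$ or to $U^2_{3t}$ for some $t\ge 1$.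
   Context: A $(0,1,2)$-multigraph $H$ is a loopless multigraph in which any two distinct vertices $u,v$ are joined by $w(u,v)\in\{0,1,2\}$ edges; its adjacency matrix has $(u,v)$-entry $w(u,v)$. The degree is $d(v)=\sum_u w(u,v)$ and $s(v)=\sum_{u\sim v}w(u,v)d(u)$. The $B$-graph of $H$ is the simple graph on $V(H)$ with $u\sim v$ iff $w(u,v)\ge1$. An eigenvalue of the adjacency matrix is main if its eigenspace is not orthogonal to the all-ones vector. For $n_1\ge1,n_2\ge0,t\ge1$, $[n_1,n_2]_t$ denotes the $(0,1,2)$-multigraph on $x_0,\dots,x_{N-1}$, $N=(n_1+n_2)t$, whose edges join $x_i$ and $x_{i+1\bmod N}$ with multiplicity $2$ if $(i\bmod(n_1+n_2))<n_1$ and $1$ otherwise (around the cycle: $n_1$ consecutive double edges then $n_2$ consecutive single edges, repeated $t$ times). $U^1_{4t}=[1,3]_t$ and $U^2_{3t}=[1,2]_t$. -}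

module Defs where


open import Level using (Level; _⊔_)
open import Data.Nat using (ℕ; zero; suc; _≤_; _<ᵇ_; _%_; NonZero)
import Data.Nat as ℕ
open import Data.Integer using (ℤ; +_)
import Data.Integer as ℤ
open import Data.Fin using (Fin; toℕ)
import Data.Fin as F
open import Data.Fin.Permutation using (Permutation; Permutation′; _⟨$⟩ʳ_)
open import Data.Bool using (if_then_else_)
open import Data.List using (List; _∷_)
open import Data.Product using (Σ; ∃; ∃-syntax; _×_; _,_)
open import Data.Sum using (_⊎_)
open import Relation.Nullary using (¬_; does)
open import Relation.Binary.PropositionalEquality using (_≡_)
open import Algebra.Bundles using (CommutativeRing)

∑ : ∀ {n} → (Fin n → ℕ) → ℕ
∑ {zero}  f = 0
∑ {suc n} f = f F.zero ℕ.+ ∑ (λ i → f (F.suc i))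

-- (0,1,2)-multigraphs on vertex set Fin n, given by the weight
-- function w (= the adjacency matrix).

record Is012 (n : ℕ) (w : Fin n → Fin n → ℕ) : Set where
  field
    loopless  : ∀ u → w u u ≡ 0
    symmetric : ∀ u v → w u v ≡ w v u
    atMost2   : ∀ u v → w u v ≤ 2

deg : ∀ {n} → (Fin n → Fin n → ℕ) → Fin n → ℕ
deg w v = ∑ (λ u → w u v)

-- s(v) = Σ_{u ~ v} w(u,v) d(u)  (non-neighbours contribute w(u,v) = 0)
sdeg : ∀ {n} → (Fin n → Fin n → ℕ) → Fin n → ℕ
sdeg w v = ∑ (λ u → w u v ℕ.* deg w u)

-- Cyclic successor on Fin N: next i = i + 1 mod N.
next : ∀ {N} → Fin N → Fin N
next {suc zero}    F.zero    = F.zero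
next {suc (suc m)} F.zero    = F.suc F.zero
next {suc (suc m)} (F.suc i) with next {suc m} i
... | F.zero  = F.zero
... | F.suc r = F.suc (F.suc r)

-- A labelling c of the vertices along the cycle such that the B-graph
-- of H is the cycle c 0, c 1, …, c (n-1), c 0: c i and c j are joined
-- (w ≥ 1) iff j = i + 1 mod n or i = j + 1 mod n.
CycleLabelling : ∀ n → (Fin n → Fin n → ℕ) → Permutation′ n → Set
CycleLabelling n w c =
  ∀ i j → (1 ≤ w (c ⟨$⟩ʳ i) (c ⟨$⟩ʳ j) → (j ≡ next i ⊎ i ≡ next j))
        × ((j ≡ next i ⊎ i ≡ next j) → 1 ≤ w (c ⟨$⟩ʳ i) (c ⟨$⟩ʳ j))

-- The multigraph [n1,n2]_t on x_0,…,x_{N-1}, N = (n1+n2) t: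
-- x_i x_{i+1 mod N} has multiplicity 2 if i mod (n1+n2) < n1, else 1.

ringMult : (n1 n2 : ℕ) → .{{NonZero (n1 ℕ.+ n2)}} → ℕ → ℕ
ringMult n1 n2 i = if (i % (n1 ℕ.+ n2)) <ᵇ n1 then 2 else 1

ringW : (n1 n2 t : ℕ) → .{{NonZero (n1 ℕ.+ n2)}} →
        Fin ((n1 ℕ.+ n2) ℕ.* t) → Fin ((n1 ℕ.+ n2) ℕ.* t) → ℕ
ringW n1 n2 t i j =
  if does (j F.≟ next i) then ringMult n1 n2 (toℕ i)
  else (if does (i F.≟ next j) then ringMult n1 n2 (toℕ j) else 0)

IsoRing : (n : ℕ) → (Fin n → Fin n → ℕ) → (n1 n2 t : ℕ) → .{{NonZero (n1 ℕ.+ n2)}} → Set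
IsoRing n w n1 n2 t =
  Σ (Permutation ((n1 ℕ.+ n2) ℕ.* t) n) λ φ →
    ∀ i j → w (φ ⟨$⟩ʳ i) (φ ⟨$⟩ʳ j) ≡ ringW n1 n2 t i j

-- U^1_{4t} = [1,3]_t ,  U^2_{3t} = [1,2]_t
IsoU1 : (n : ℕ) → (Fin n → Fin n → ℕ) → ℕ → Set
IsoU1 n w t = IsoRing n w 1 3 t

IsoU2 : (n : ℕ) → (Fin n → Fin n → ℕ) → ℕ → Set
IsoU2 n w t = IsoRing n w 1 2 t

-- The adjacency matrix is an integer symmetric matrix;
-- its eigenvalues are real algebraic numbers.  Since stdlib has no real
-- or complex numbers, we work over an arbitrary algebraically closed
-- field of characteristic 0 (e.g. ℂ).

module RingOps {c ℓ} (R : CommutativeRing c ℓ) where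
  open CommutativeRing R

  fromℕ : ℕ → Carrier
  fromℕ zero    = 0#
  fromℕ (suc n) = 1# + fromℕ n

  -- monic polynomial a₀ + a₁ x + … + a_{k-1} x^{k-1} + x^k, given by
  -- its lower coefficients [a₀, …, a_{k-1}]  (Horner evaluation)
  evalMonic : List Carrier → Carrier → Carrier
  evalMonic Data.List.[] x = 1#
  evalMonic (a ∷ as) x = a + x * evalMonic as x

  ∑K : ∀ {n} → (Fin n → Carrier) → Carrier
  ∑K {zero}  f = 0#
  ∑K {suc n} f = f F.zero + ∑K (λ i → f (F.suc i))

record IsACF₀ {c ℓ} (R : CommutativeRing c ℓ) : Set (c ⊔ ℓ) where
  open CommutativeRing R
  open RingOps R
  field
    inverse         : ∀ x → ¬ (x ≈ 0#) → ∃[ y ] (x * y ≈ 1#)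
    characteristic0 : ∀ n → ¬ (fromℕ (suc n) ≈ 0#)
    algClosed       : ∀ a as → ∃[ x ] (evalMonic (a ∷ as) x ≈ 0#)

module _ {c ℓ} (R : CommutativeRing c ℓ) where
  open CommutativeRing R
  open RingOps R

  -- λ is a main eigenvalue of the adjacency matrix A = (w u v):
  -- its eigenspace contains a vector x with A x = λ x not orthogonal to
  -- the all-ones vector, i.e. Σ_v x v ≠ 0 (such x is automatically ≠ 0).
  IsMainEigenvalue : ∀ {n} → (Fin n → Fin n → ℕ) → Carrier → Set (c ⊔ ℓ)
  IsMainEigenvalue {n} w λ′ =
    ∃[ x ] ((∀ u → ∑K (λ v → fromℕ (w u v) * x v) ≈ λ′ * x u)
            × ¬ (∑K x ≈ 0#))

  ExactlyTwoMain : ∀ {n} → (Fin n → Fin n → ℕ) → Set (c ⊔ ℓ)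
  ExactlyTwoMain w =
    ∃[ μ₁ ] ∃[ μ₂ ] (¬ (μ₁ ≈ μ₂) × IsMainEigenvalue w μ₁ × IsMainEigenvalue w μ₂
      × (∀ μ → IsMainEigenvalue w μ → μ ≈ μ₁ ⊎ μ ≈ μ₂))

-- Read the edge weights of H along its cycle, starting at the edge v₂v₁, as a sequence
-- g : ℕ → {1,2} of period n.  The vertex between the edges g(j+1) and g(j+2) has
-- d = g(j+1) + g(j+2) and s = g(j+1)(g(j) + g(j+1)) + g(j+2)(g(j+2) + g(j+3)), so
-- a d + b = s determines g(j+3) from the three weights before it.  From g = 1, 2, 1 the first
-- two vertex equations leave three possibilities for (a, b), each forcing a periodic sequence:
-- 1,2 makes H 3-regular, and then summing A x = μ x over all rows gives μ Σx = 3 Σx, so 3 is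
-- the only main eigenvalue; 1,2,1,1 gives H ≅ U¹₄ₜ; 1,2,1 gives H ≅ U²₃ₜ.
module Submission where

open import Defs
open import Level using (Level)
open import Algebra.Bundles using (CommutativeRing)
import Data.Nat as ℕ
open import Data.Fin using (Fin; zero; suc)
open import Data.Fin.Permutation using (Permutation; Permutation′; permutation; _⟨$⟩ʳ_; _⟨$⟩ˡ_; inverseˡ; inverseʳ)
open import Data.Product using (_×_; _,_; proj₁; proj₂; ∃-syntax; map₂)
open import Relation.Nullary using (¬_)
import Relation.Binary.PropositionalEquality as ≡
open ≡ using (_≡_)

module _ {c ℓ} (R : CommutativeRing c ℓ) where
  open CommutativeRing R hiding (zero)
  open RingOps R
  open import Algebra.Properties.Semiring.Sum semiring
    using (sum; ∑-comm; *-distribˡ-sum; *-distribʳ-sum; sum-cong-≋)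
  open import Relation.Binary.Reasoning.Setoid setoid

  private
    ∑K≡sum : ∀ {n} (f : Fin n → Carrier) → ∑K f ≡ sum f
    ∑K≡sum {ℕ.zero}  f = ≡.refl
    ∑K≡sum {ℕ.suc n} f = ≡.cong (f zero +_) (∑K≡sum (λ i → f (suc i)))

    fromℕ-+ : ∀ m n → fromℕ (m ℕ.+ n) ≈ fromℕ m + fromℕ n
    fromℕ-+ ℕ.zero    n = sym (+-identityˡ _)
    fromℕ-+ (ℕ.suc m) n = trans (+-congˡ (fromℕ-+ m n)) (sym (+-assoc _ _ _))

    fromℕ-∑ : ∀ {n} (f : Fin n → ℕ.ℕ) → fromℕ (∑ f) ≈ sum (λ i → fromℕ (f i))
    fromℕ-∑ {ℕ.zero}  f = refl
    fromℕ-∑ {ℕ.suc n} f = trans (fromℕ-+ (f zero) _) (+-congˡ (fromℕ-∑ (λ i → f (suc i))))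

  module _ {n} (w : Fin n → Fin n → ℕ.ℕ) (r : ℕ.ℕ) (regular : ∀ v → deg w v ≡ r) where

    eigenvector-sum : ∀ {μ x} → (∀ u → ∑K (λ v → fromℕ (w u v) * x v) ≈ μ * x u) →
                      μ * ∑K x ≈ fromℕ r * ∑K x
    eigenvector-sum {μ} {x} eigen = begin
      μ * ∑K x                                               ≡⟨ ≡.cong (μ *_) (∑K≡sum x) ⟩
      μ * sum x                                              ≈⟨ *-distribˡ-sum μ x ⟩
      sum (λ u → μ * x u)                                    ≈⟨ sum-cong-≋ row ⟨
      sum (λ u → sum (λ v → fromℕ (w u v) * x v))            ≈⟨ ∑-comm (λ u v → fromℕ (w u v) * x v) ⟩
      sum (λ v → sum (λ u → fromℕ (w u v) * x v))            ≈⟨ sum-cong-≋ column ⟩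
      sum (λ v → fromℕ r * x v)                              ≈⟨ *-distribˡ-sum (fromℕ r) x ⟨
      fromℕ r * sum x                                        ≡⟨ ≡.cong (fromℕ r *_) (∑K≡sum x) ⟨
      fromℕ r * ∑K x                                         ∎
      where
      row : ∀ u → sum (λ v → fromℕ (w u v) * x v) ≈ μ * x u
      row u = trans (reflexive (≡.sym (∑K≡sum (λ v → fromℕ (w u v) * x v)))) (eigen u)

      column : ∀ v → sum (λ u → fromℕ (w u v) * x v) ≈ fromℕ r * x v
      column v = begin
        sum (λ u → fromℕ (w u v) * x v)  ≈⟨ *-distribʳ-sum (x v) (λ u → fromℕ (w u v)) ⟨
        sum (λ u → fromℕ (w u v)) * x v  ≈⟨ *-congʳ (fromℕ-∑ (λ u → w u v)) ⟨
        fromℕ (deg w v) * x v            ≡⟨ ≡.cong (λ d → fromℕ d * x v) (regular v) ⟩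
        fromℕ r * x v                    ∎

    module _ (inverse : ∀ x → ¬ x ≈ 0# → ∃[ y ] x * y ≈ 1#) where

      mainEigenvalue-regular : ∀ {μ} → IsMainEigenvalue R w μ → μ ≈ fromℕ r
      mainEigenvalue-regular {μ} (x , eigen , ∑x≉0) with inverse (∑K x) ∑x≉0
      ... | y , ∑x*y≈1 = begin
        μ                    ≈⟨ *-identityʳ μ ⟨
        μ * 1#               ≈⟨ *-congˡ ∑x*y≈1 ⟨
        μ * (∑K x * y)       ≈⟨ *-assoc μ (∑K x) y ⟨
        μ * ∑K x * y         ≈⟨ *-congʳ (eigenvector-sum eigen) ⟩
        fromℕ r * ∑K x * y   ≈⟨ *-assoc (fromℕ r) (∑K x) y ⟩
        fromℕ r * (∑K x * y) ≈⟨ *-congˡ ∑x*y≈1 ⟩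
        fromℕ r * 1#         ≈⟨ *-identityʳ (fromℕ r) ⟩
        fromℕ r              ∎

      regular⇒¬ExactlyTwoMain : ¬ ExactlyTwoMain R w
      regular⇒¬ExactlyTwoMain (μ₁ , μ₂ , μ₁≉μ₂ , main₁ , main₂ , _) =
        μ₁≉μ₂ (trans (mainEigenvalue-regular main₁) (sym (mainEigenvalue-regular main₂)))

open import Data.Nat
  using (ℕ; zero; suc; _+_; _*_; _≤_; _<_; s≤s; NonZero; _%_; _<ᵇ_)
open import Data.Bool using (if_then_else_)
open import Data.Nat.Properties
  using (suc-injective; +-cancelˡ-≡; *-cancelˡ-≡; *-zeroʳ; ≤-refl; <-trans; <-irrefl; n<1+n;
         m≢1+n+m; n<1⇒n≡0; ≰⇒>; n≢0⇒n>0; +-comm; +-identityʳ; *-suc)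
open import Data.Nat.DivMod using ([m+n]%n≡m%n)
open import Data.Nat.Tactic.RingSolver using (solve-∀)
open import Data.Integer as ℤ using (ℤ; +_)
import Data.Integer.Properties as ℤ
open import Data.Fin using (toℕ; fromℕ; inject₁; cast; _≟_)
open import Data.Fin.Properties using (toℕ-injective; toℕ<n; toℕ-fromℕ; toℕ-inject₁; toℕ-cast; cast-is-id; cast-involutive)
open import Data.Sum using (_⊎_; inj₁; inj₂; [_,_]′)
open import Data.Empty using (⊥-elim)
open import Function using (case_of_; _∘_)
open import Relation.Nullary using (yes; no; contradiction)
open ≡ using (_≢_; refl; sym; trans; cong; cong₂; subst; module ≡-Reasoning)

toℕ-next : ∀ {N} (i : Fin N) →
  (suc (toℕ i) < N × toℕ (next i) ≡ suc (toℕ i)) ⊎ (suc (toℕ i) ≡ N × toℕ (next i) ≡ 0)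
toℕ-next {suc zero}    zero    = inj₂ (refl , refl)
toℕ-next {suc (suc m)} zero    = inj₁ (s≤s (s≤s ℕ.z≤n) , refl)
toℕ-next {suc (suc m)} (suc i) with next {suc m} i | toℕ-next {suc m} i
... | zero  | inj₂ (wraps , _) = inj₂ (cong suc wraps , refl)
... | suc r | inj₁ (lt , eq)    = inj₁ (s≤s lt , cong suc eq)
... | zero  | inj₁ (_ , ())
... | suc r | inj₂ (_ , ())

next-injective : ∀ {N} {i j : Fin N} → next i ≡ next j → i ≡ j
next-injective {i = i} {j} eq with toℕ-next i | toℕ-next j
... | inj₁ (_ , p) | inj₁ (_ , q) = toℕ-injective (suc-injective (trans (sym p) (trans (cong toℕ eq) q)))
... | inj₂ (p , _) | inj₂ (q , _) = toℕ-injective (suc-injective (trans p (sym q)))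
... | inj₁ (_ , p) | inj₂ (_ , q) = contradiction (trans (sym p) (trans (cong toℕ eq) q)) λ ()
... | inj₂ (_ , p) | inj₁ (_ , q) = contradiction (trans (sym p) (trans (cong toℕ eq) q)) λ ()

next∘next≢id : ∀ {k} (i : Fin (3 + k)) → next (next i) ≢ i
next∘next≢id {k} i eq with toℕ-next i | toℕ-next (next i)
... | inj₁ (_ , p) | inj₁ (_ , q) = m≢1+n+m (toℕ i) {1} (begin
  toℕ i                 ≡⟨ cong toℕ eq ⟨
  toℕ (next (next i))   ≡⟨ q ⟩
  suc (toℕ (next i))    ≡⟨ cong suc p ⟩
  suc (suc (toℕ i))     ∎)
  where open ≡-Reasoning
... | inj₁ (_ , p) | inj₂ (wraps , q) = contradiction (begin
  3 + k                 ≡⟨ wraps ⟨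
  suc (toℕ (next i))    ≡⟨ cong suc p ⟩
  suc (suc (toℕ i))     ≡⟨ cong (λ t → suc (suc (toℕ t))) eq ⟨
  suc (suc (toℕ (next (next i)))) ≡⟨ cong (λ t → suc (suc t)) q ⟩
  2                     ∎) λ ()
  where open ≡-Reasoning
... | inj₂ (wraps , p) | inj₁ (_ , q) = contradiction (begin
  3 + k                 ≡⟨ wraps ⟨
  suc (toℕ i)           ≡⟨ cong (λ t → suc (toℕ t)) eq ⟨
  suc (toℕ (next (next i))) ≡⟨ cong suc q ⟩
  suc (suc (toℕ (next i)))  ≡⟨ cong (λ t → suc (suc t)) p ⟩
  2                     ∎) λ ()
  where open ≡-Reasoning
... | inj₂ (_ , p) | inj₂ (wraps , _) =
  contradiction (trans (sym wraps) (cong suc p)) λ ()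

next^ : ∀ {N} → ℕ → Fin (suc N)
next^ zero    = zero
next^ (suc m) = next (next^ m)

toℕ-next^ : ∀ {N} m → m < suc N → toℕ (next^ {N} m) ≡ m
toℕ-next^ zero    _  = refl
toℕ-next^ (suc m) lt with toℕ-next (next^ m) | toℕ-next^ m (<-trans (n<1+n m) lt)
... | inj₁ (_ , p)     | ih = trans p (cong suc ih)
... | inj₂ (wraps , _) | ih = contradiction (trans (cong suc (sym ih)) wraps) λ eq → <-irrefl eq lt

next^-toℕ : ∀ {N} (i : Fin (suc N)) → next^ (toℕ i) ≡ i
next^-toℕ i = toℕ-injective (toℕ-next^ (toℕ i) (toℕ<n i))

next^-fromℕ : ∀ {N} → next^ N ≡ fromℕ N
next^-fromℕ {N} = toℕ-injective (trans (toℕ-next^ N ≤-refl) (sym (toℕ-fromℕ N)))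

next^-inject₁-fromℕ : ∀ {N} → next^ {suc N} N ≡ inject₁ (fromℕ N)
next^-inject₁-fromℕ {N} = toℕ-injective (begin
  toℕ (next^ N)            ≡⟨ toℕ-next^ N (<-trans (n<1+n N) (n<1+n (suc N))) ⟩
  N                        ≡⟨ toℕ-fromℕ N ⟨
  toℕ (fromℕ N)            ≡⟨ toℕ-inject₁ (fromℕ N) ⟨
  toℕ (inject₁ (fromℕ N))  ∎)
  where open ≡-Reasoning

next^-wrap : ∀ {N} → next^ {N} (suc N) ≡ zero
next^-wrap {N} with toℕ-next (next^ {N} N)
... | inj₁ (lt , _) = contradiction (subst (λ t → suc t < suc N) (toℕ-next^ N ≤-refl) lt) (<-irrefl refl)
... | inj₂ (_ , p)  = toℕ-injective p

next^-periodic : ∀ {N} m → next^ {N} (m + suc N) ≡ next^ m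
next^-periodic zero    = next^-wrap
next^-periodic (suc m) = cong next (next^-periodic m)

∑-zero : ∀ {N} (f : Fin N → ℕ) → (∀ u → f u ≡ 0) → ∑ f ≡ 0
∑-zero {zero}  f f≡0 = refl
∑-zero {suc N} f f≡0 = cong₂ _+_ (f≡0 zero) (∑-zero (λ i → f (suc i)) (λ u → f≡0 (suc u)))

∑-single : ∀ {N} (f : Fin N → ℕ) p → (∀ u → u ≢ p → f u ≡ 0) → ∑ f ≡ f p
∑-single {suc N} f zero    off =
  trans (cong (_+_ (f zero)) (∑-zero (λ i → f (suc i)) (λ u → off (suc u) λ ()))) (+-identityʳ (f zero))
∑-single {suc N} f (suc p) off =
  cong₂ _+_ (off zero λ ()) (∑-single (λ i → f (suc i)) p (λ u u≢p → off (suc u) λ { refl → u≢p refl }))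

∑-pair : ∀ {N} (f : Fin N → ℕ) p q → p ≢ q → (∀ u → u ≢ p → u ≢ q → f u ≡ 0) → ∑ f ≡ f p + f q
∑-pair {suc N} f zero    zero    p≢q off = contradiction refl p≢q
∑-pair {suc N} f zero    (suc q) p≢q off =
  cong (_+_ (f zero)) (∑-single (λ i → f (suc i)) q (λ u u≢q → off (suc u) (λ ()) λ { refl → u≢q refl }))
∑-pair {suc N} f (suc p) zero    p≢q off =
  trans (cong (_+_ (f zero)) (∑-single (λ i → f (suc i)) p (λ u u≢p → off (suc u) (λ { refl → u≢p refl }) λ ())))
        (+-comm (f zero) (f (suc p)))
∑-pair {suc N} f (suc p) (suc q) p≢q off =
  cong₂ _+_ (off zero (λ ()) (λ ()))
            (∑-pair (λ i → f (suc i)) p q (p≢q ∘ cong suc)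
                    (λ u u≢p u≢q → off (suc u) (λ { refl → u≢p refl }) λ { refl → u≢q refl }))

cast-next : ∀ {N M} (eq : N ≡ M) (x : Fin N) → cast eq (next x) ≡ next (cast eq x)
cast-next refl x = trans (cast-is-id refl (next x)) (cong next (sym (cast-is-id refl x)))

cast-injective : ∀ {N M} (eq : N ≡ M) {x y : Fin N} → cast eq x ≡ cast eq y → x ≡ y
cast-injective eq {x} {y} e = toℕ-injective (trans (sym (toℕ-cast eq x)) (trans (cong toℕ e) (toℕ-cast eq y)))

-- Balanced a b x y z u is the relation a d(v) + b = s(v) at a vertex v of a cycle whose two
-- edges have weights y and z, the edges beyond its two neighbours having weights x and u.
Balanced : ℤ → ℤ → ℕ → ℕ → ℕ → ℕ → Set
Balanced a b x y z u = a ℤ.* + (y + z) ℤ.+ b ≡ + (y * (x + y) + z * (z + u))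

BalancedSeq : ℤ → ℤ → (ℕ → ℕ) → Set
BalancedSeq a b g = ∀ j → Balanced a b (g j) (g (1 + j)) (g (2 + j)) (g (3 + j))

Balanced-cong : ∀ a b {x y z u x′ y′ z′ u′} → x ≡ x′ → y ≡ y′ → z ≡ z′ → u ≡ u′ →
                Balanced a b x y z u → Balanced a b x′ y′ z′ u′
Balanced-cong a b refl refl refl refl balanced = balanced

Balanced-unique : ∀ a b {x y z u u′} → .{{NonZero z}} →
                  Balanced a b x y z u → Balanced a b x y z u′ → u ≡ u′
Balanced-unique a b {x} {y} {z} {u} {u′} p q =
  +-cancelˡ-≡ z u u′ (*-cancelˡ-≡ (z + u) (z + u′) z
    (+-cancelˡ-≡ (y * (x + y)) _ _ (ℤ.+-injective (trans (sym p) q))))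

BalancedSeq-unique : ∀ a b {g h} → BalancedSeq a b g → BalancedSeq a b h → (∀ j → NonZero (g j)) →
                     g 0 ≡ h 0 → g 1 ≡ h 1 → g 2 ≡ h 2 → ∀ j → g j ≡ h j
BalancedSeq-unique a b {g} {h} bal-g bal-h g≢0 e₀ e₁ e₂ j = proj₁ (agree j)
  where
  agree : ∀ j → g j ≡ h j × g (1 + j) ≡ h (1 + j) × g (2 + j) ≡ h (2 + j)
  agree zero = e₀ , e₁ , e₂
  agree (suc j) with agree j
  ... | p , q , r = q , r , Balanced-unique a b {{g≢0 (2 + j)}} (bal-g j)
                              (Balanced-cong a b (sym p) (sym q) (sym r) refl (bal-h j))

alternatingWeights : ℕ → ℕ
alternatingWeights 0             = 1
alternatingWeights 1             = 2
alternatingWeights (suc (suc j)) = alternatingWeights j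

u1Weights : ℕ → ℕ
u1Weights 0                         = 1
u1Weights 1                         = 2
u1Weights 2                         = 1
u1Weights 3                         = 1
u1Weights (suc (suc (suc (suc j)))) = u1Weights j

u2Weights : ℕ → ℕ
u2Weights 0                   = 1
u2Weights 1                   = 2
u2Weights 2                   = 1
u2Weights (suc (suc (suc j))) = u2Weights j

alternatingWeights-balanced : ∀ a b → a ℤ.* + 3 ℤ.+ b ≡ + 9 → BalancedSeq a b alternatingWeights
alternatingWeights-balanced a b e₃ 0             = e₃
alternatingWeights-balanced a b e₃ 1             = e₃
alternatingWeights-balanced a b e₃ (suc (suc j)) = alternatingWeights-balanced a b e₃ j

u1Weights-balanced : ∀ a b → a ℤ.* + 3 ℤ.+ b ≡ + 8 → a ℤ.* + 2 ℤ.+ b ≡ + 5 → BalancedSeq a b u1Weights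
u1Weights-balanced a b e₃ e₂ 0                         = e₃
u1Weights-balanced a b e₃ e₂ 1                         = e₂
u1Weights-balanced a b e₃ e₂ 2                         = e₂
u1Weights-balanced a b e₃ e₂ 3                         = e₃
u1Weights-balanced a b e₃ e₂ (suc (suc (suc (suc j)))) = u1Weights-balanced a b e₃ e₂ j

u2Weights-balanced : ∀ a b → a ℤ.* + 3 ℤ.+ b ≡ + 8 → a ℤ.* + 2 ℤ.+ b ≡ + 6 → BalancedSeq a b u2Weights
u2Weights-balanced a b e₃ e₂ 0                   = e₃
u2Weights-balanced a b e₃ e₂ 1                   = e₂
u2Weights-balanced a b e₃ e₂ 2                   = e₃
u2Weights-balanced a b e₃ e₂ (suc (suc (suc j))) = u2Weights-balanced a b e₃ e₂ j

NonZero-1or2 : ∀ {x} → x ≡ 1 ⊎ x ≡ 2 → NonZero x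
NonZero-1or2 (inj₁ refl) = _
NonZero-1or2 (inj₂ refl) = _

BalancedSeq-classification :
  ∀ a b {g} → (∀ j → g j ≡ 1 ⊎ g j ≡ 2) → BalancedSeq a b g → g 0 ≡ 1 → g 1 ≡ 2 → g 2 ≡ 1 →
  (∀ j → g j ≡ alternatingWeights j) ⊎ (∀ j → g j ≡ u1Weights j) ⊎ (∀ j → g j ≡ u2Weights j)
BalancedSeq-classification a b g∈12 bal e₀ e₁ e₂ with g∈12 3 | g∈12 4
... | inj₂ e₃ | _ = inj₁ (BalancedSeq-unique a b bal
        (alternatingWeights-balanced a b (Balanced-cong a b e₀ e₁ e₂ e₃ (bal 0)))
        (NonZero-1or2 ∘ g∈12) e₀ e₁ e₂)
... | inj₁ e₃ | inj₁ e₄ = inj₂ (inj₁ (BalancedSeq-unique a b bal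
        (u1Weights-balanced a b (Balanced-cong a b e₀ e₁ e₂ e₃ (bal 0)) (Balanced-cong a b e₁ e₂ e₃ e₄ (bal 1)))
        (NonZero-1or2 ∘ g∈12) e₀ e₁ e₂))
... | inj₁ e₃ | inj₂ e₄ = inj₂ (inj₂ (BalancedSeq-unique a b bal
        (u2Weights-balanced a b (Balanced-cong a b e₀ e₁ e₂ e₃ (bal 0)) (Balanced-cong a b e₁ e₂ e₃ e₄ (bal 1)))
        (NonZero-1or2 ∘ g∈12) e₀ e₁ e₂))

alternatingWeights-sum : ∀ j → alternatingWeights j + alternatingWeights (suc j) ≡ 3
alternatingWeights-sum 0             = refl
alternatingWeights-sum 1             = refl
alternatingWeights-sum (suc (suc j)) = alternatingWeights-sum j

u1Weights-period : ∀ m → u1Weights (suc m) ≡ 2 → ∃[ t ] 4 * t ≡ m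
u1Weights-period 0 _ = 0 , refl
u1Weights-period 1 ()
u1Weights-period 2 ()
u1Weights-period 3 ()
u1Weights-period (suc (suc (suc (suc m)))) e with u1Weights-period m e
... | t , 4t≡m = suc t , trans (*-suc 4 t) (cong (_+_ 4) 4t≡m)

u2Weights-period : ∀ m → u2Weights (suc m) ≡ 2 → ∃[ t ] 3 * t ≡ m
u2Weights-period 0 _ = 0 , refl
u2Weights-period 1 ()
u2Weights-period 2 ()
u2Weights-period (suc (suc (suc m))) e with u2Weights-period m e
... | t , 3t≡m = suc t , trans (*-suc 3 t) (cong (_+_ 3) 3t≡m)

ringMult-periodic : ∀ n₁ n₂ .{{_ : NonZero (n₁ + n₂)}} i → ringMult n₁ n₂ (n₁ + n₂ + i) ≡ ringMult n₁ n₂ i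
ringMult-periodic n₁ n₂ i =
  cong (λ r → if r <ᵇ n₁ then 2 else 1) (trans (cong (_% (n₁ + n₂)) (+-comm (n₁ + n₂) i)) ([m+n]%n≡m%n i (n₁ + n₂)))

ringMult-u1Weights : ∀ i → ringMult 1 3 i ≡ u1Weights (suc i)
ringMult-u1Weights 0                         = refl
ringMult-u1Weights 1                         = refl
ringMult-u1Weights 2                         = refl
ringMult-u1Weights 3                         = refl
ringMult-u1Weights (suc (suc (suc (suc i)))) = trans (ringMult-periodic 1 3 i) (ringMult-u1Weights i)

ringMult-u2Weights : ∀ i → ringMult 1 2 i ≡ u2Weights (suc i)
ringMult-u2Weights 0                   = refl
ringMult-u2Weights 1                   = refl
ringMult-u2Weights 2                   = refl
ringMult-u2Weights (suc (suc (suc i))) = trans (ringMult-periodic 1 2 i) (ringMult-u2Weights i)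

module CycleLabelled (k : ℕ) (w : Fin (3 + k) → Fin (3 + k) → ℕ) (H : Is012 (3 + k) w)
                     (σ : Permutation′ (3 + k)) (cyc : CycleLabelling (3 + k) w σ) where

  open Is012 H

  n : ℕ
  n = 3 + k

  σ-injective : ∀ {i j} → σ ⟨$⟩ʳ i ≡ σ ⟨$⟩ʳ j → i ≡ j
  σ-injective eq = trans (sym (inverseˡ σ)) (trans (cong (σ ⟨$⟩ˡ_) eq) (inverseˡ σ))

  σ⁻¹-≡ : ∀ {u i} → σ ⟨$⟩ˡ u ≡ i → u ≡ σ ⟨$⟩ʳ i
  σ⁻¹-≡ eq = trans (sym (inverseʳ σ)) (cong (σ ⟨$⟩ʳ_) eq)

  nonadjacent-weight : ∀ {i j} → j ≢ next i → i ≢ next j → w (σ ⟨$⟩ʳ i) (σ ⟨$⟩ʳ j) ≡ 0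
  nonadjacent-weight j≢ i≢ = n<1⇒n≡0 (≰⇒> λ adjacent → [ j≢ , i≢ ]′ (proj₁ (cyc _ _) adjacent))

  -- The cycle read from v₂: vertex 0, 1, 2 are the vertices v₂, v₁, u₁ of the paper.
  vertex : ℕ → Fin n
  vertex m = σ ⟨$⟩ʳ next^ (m + suc k)

  weight : ℕ → ℕ
  weight m = w (vertex m) (vertex (suc m))

  weight-1or2 : ∀ m → weight m ≡ 1 ⊎ weight m ≡ 2
  weight-1or2 m with weight m | proj₂ (cyc (next^ (m + suc k)) _) (inj₁ refl) | atMost2 (vertex m) (vertex (suc m))
  ... | 0                 | ()  | _
  ... | 1                 | _ | _               = inj₁ refl
  ... | 2                 | _ | _               = inj₂ refl
  ... | suc (suc (suc _)) | _ | s≤s (s≤s ())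

  vertex-distinct : ∀ m → vertex m ≢ vertex (2 + m)
  vertex-distinct m eq = next∘next≢id _ (sym (σ-injective eq))

  weight-off-neighbours : ∀ m u → u ≢ vertex m → u ≢ vertex (2 + m) → w u (vertex (suc m)) ≡ 0
  weight-off-neighbours m u u≢ u≢′ = subst (λ v → w v (vertex (suc m)) ≡ 0) (inverseʳ σ)
    (nonadjacent-weight (λ eq → u≢ (σ⁻¹-≡ (sym (next-injective eq)))) (λ eq → u≢′ (σ⁻¹-≡ eq)))

  deg-vertex : ∀ m → deg w (vertex (suc m)) ≡ weight m + weight (suc m)
  deg-vertex m =
    trans (∑-pair (λ u → w u (vertex (suc m))) (vertex m) (vertex (2 + m)) (vertex-distinct m)
                  (weight-off-neighbours m))
          (cong (_+_ (weight m)) (symmetric _ _))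

  sdeg-vertex : ∀ m → sdeg w (vertex (suc m)) ≡
                      weight m * deg w (vertex m) + weight (suc m) * deg w (vertex (2 + m))
  sdeg-vertex m =
    trans (∑-pair (λ u → w u (vertex (suc m)) * deg w u) (vertex m) (vertex (2 + m)) (vertex-distinct m)
                  (λ u u≢ u≢′ → cong (_* deg w u) (weight-off-neighbours m u u≢ u≢′)))
          (cong (λ x → weight m * deg w (vertex m) + x * deg w (vertex (2 + m))) (symmetric _ _))

  weight-balanced : ∀ a b → (∀ v → a ℤ.* + deg w v ℤ.+ b ≡ + sdeg w v) → BalancedSeq a b weight
  weight-balanced a b relation j = begin
    a ℤ.* + (weight (1 + j) + weight (2 + j)) ℤ.+ b
      ≡⟨ cong (λ d → a ℤ.* + d ℤ.+ b) (deg-vertex (suc j)) ⟨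
    a ℤ.* + deg w (vertex (2 + j)) ℤ.+ b
      ≡⟨ relation (vertex (2 + j)) ⟩
    + sdeg w (vertex (2 + j))
      ≡⟨ cong +_ (sdeg-vertex (suc j)) ⟩
    + (weight (1 + j) * deg w (vertex (1 + j)) + weight (2 + j) * deg w (vertex (3 + j)))
      ≡⟨ cong₂ (λ d d′ → + (weight (1 + j) * d + weight (2 + j) * d′)) (deg-vertex j) (deg-vertex (2 + j)) ⟩
    + (weight (1 + j) * (weight j + weight (1 + j)) + weight (2 + j) * (weight (2 + j) + weight (3 + j))) ∎
    where open ≡-Reasoning

  weight-v₂v₁ : w (σ ⟨$⟩ʳ fromℕ (suc (suc k))) (σ ⟨$⟩ʳ inject₁ (fromℕ (suc k))) ≡ 1 → weight 0 ≡ 1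
  weight-v₂v₁ eq = trans (cong₂ (λ i j → w (σ ⟨$⟩ʳ i) (σ ⟨$⟩ʳ j)) next^-inject₁-fromℕ next^-fromℕ)
                         (trans (symmetric _ _) eq)

  weight-v₁u₁ : w (σ ⟨$⟩ʳ zero) (σ ⟨$⟩ʳ fromℕ (suc (suc k))) ≡ 2 → weight 1 ≡ 2
  weight-v₁u₁ eq = trans (cong₂ (λ i j → w (σ ⟨$⟩ʳ i) (σ ⟨$⟩ʳ j)) next^-fromℕ next^-wrap)
                         (trans (symmetric _ _) eq)

  weight-u₁u₂ : w (σ ⟨$⟩ʳ zero) (σ ⟨$⟩ʳ suc zero) ≡ 1 → weight 2 ≡ 1
  weight-u₁u₂ = trans (cong (λ i → w (σ ⟨$⟩ʳ i) (σ ⟨$⟩ʳ next i)) next^-wrap)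

  weight-periodic : ∀ m → weight (m + n) ≡ weight m
  weight-periodic m = cong₂ (λ i j → w (σ ⟨$⟩ʳ i) (σ ⟨$⟩ʳ j)) (next^-shift m) (next^-shift (suc m))
    where
    next^-shift : ∀ m → next^ (m + n + suc k) ≡ next^ (m + suc k)
    next^-shift m = trans (cong next^ (shift m n (suc k))) (next^-periodic (m + suc k))
      where
      shift : ∀ m n s → m + n + s ≡ m + s + n
      shift = solve-∀

  prev : Fin n → Fin n
  prev x = next^ (suc (toℕ x) + suc k)

  next-prev : ∀ x → next (prev x) ≡ x
  next-prev x = trans (cong next^ (around (toℕ x) k)) (trans (next^-periodic (toℕ x)) (next^-toℕ x))
    where
    around : ∀ t k → suc (suc t + suc k) ≡ t + suc (suc (suc k))
    around = solve-∀

  prev-next : ∀ x → prev (next x) ≡ x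
  prev-next x with toℕ-next x
  ... | inj₁ (_ , p)     = trans (cong (λ t → next^ (suc t + suc k)) p) (next-prev x)
  ... | inj₂ (wraps , p) = trans (cong (λ t → next^ (suc t + suc k)) p)
                                 (trans (cong next^ (suc-injective (sym wraps))) (next^-toℕ x))

  vertex-surjective : ∀ v → ∃[ m ] vertex (suc m) ≡ v
  vertex-surjective v = suc (toℕ (σ ⟨$⟩ˡ v)) , trans (cong (σ ⟨$⟩ʳ_) (next-prev _)) (inverseʳ σ)

  alternating⇒regular : (∀ j → weight j ≡ alternatingWeights j) → ∀ v → deg w v ≡ 3
  alternating⇒regular alternating v with vertex-surjective v
  ... | m , refl = trans (deg-vertex m)
                         (trans (cong₂ _+_ (alternating m) (alternating (suc m))) (alternatingWeights-sum m))

  ringIso : ∀ n₁ n₂ .{{_ : NonZero (n₁ + n₂)}} → ∃[ t ] (n₁ + n₂) * t ≡ n →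
            (∀ i → weight (suc i) ≡ ringMult n₁ n₂ i) → ∃[ t ] (1 ≤ t × IsoRing n w n₁ n₂ t)
  ringIso n₁ n₂ (t , size) follows = t , n≢0⇒n>0 t≢0 , φ , φ-weights
    where
    t≢0 : t ≢ 0
    t≢0 t≡0 = contradiction (trans (sym (*-zeroʳ (n₁ + n₂))) (trans (cong (_*_ (n₁ + n₂)) (sym t≡0)) size)) λ ()

    ρ : Fin ((n₁ + n₂) * t) → Fin n
    ρ i = prev (cast size i)

    ρ-next : ∀ i → ρ (next i) ≡ next (ρ i)
    ρ-next i = trans (cong prev (cast-next size i)) (trans (prev-next (cast size i)) (sym (next-prev _)))

    ρ-injective : ∀ {i j} → ρ i ≡ ρ j → i ≡ j
    ρ-injective eq =
      cast-injective size (trans (sym (next-prev _)) (trans (cong next eq) (next-prev _)))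

    φ : Permutation ((n₁ + n₂) * t) n
    φ = permutation (λ i → σ ⟨$⟩ʳ ρ i) (λ v → cast (sym size) (next (σ ⟨$⟩ˡ v)))
      (λ v → trans (cong (λ x → σ ⟨$⟩ʳ prev x) (cast-involutive size (sym size) _))
                   (trans (cong (σ ⟨$⟩ʳ_) (prev-next _)) (inverseʳ σ)))
      (λ i → trans (cong (λ x → cast (sym size) (next x)) (inverseˡ σ))
                   (trans (cong (cast (sym size)) (next-prev _)) (cast-involutive (sym size) size i)))

    edge : ∀ i → w (φ ⟨$⟩ʳ i) (φ ⟨$⟩ʳ next i) ≡ ringMult n₁ n₂ (toℕ i)
    edge i = trans (cong (λ x → w (σ ⟨$⟩ʳ ρ i) (σ ⟨$⟩ʳ x)) (ρ-next i))
                   (trans (follows (toℕ (cast size i))) (cong (ringMult n₁ n₂) (toℕ-cast size i)))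

    φ-weights : ∀ i j → w (φ ⟨$⟩ʳ i) (φ ⟨$⟩ʳ j) ≡ ringW n₁ n₂ t i j
    φ-weights i j with j ≟ next i
    ... | yes refl = edge i
    ... | no j≢ with i ≟ next j
    ...   | yes refl = trans (symmetric _ _) (edge j)
    ...   | no i≢ = nonadjacent-weight (λ eq → j≢ (ρ-injective (trans eq (sym (ρ-next i)))))
                                       (λ eq → i≢ (ρ-injective (trans eq (sym (ρ-next j)))))

  weights-period : ∀ (Q : ℕ → ℕ) → (∀ j → weight j ≡ Q j) → Q (suc n) ≡ Q 1
  weights-period Q follows = trans (sym (follows (suc n))) (trans (weight-periodic 1) (follows 1))

theorem3p5 : ∀ {c ℓ : Level} (R : CommutativeRing c ℓ) → IsACF₀ R →
    (k : ℕ) (w : Fin (suc (suc (suc k))) → Fin (suc (suc (suc k))) → ℕ) →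
    Is012 (suc (suc (suc k))) w →
    ExactlyTwoMain R w →
    (a b : ℤ) → (∀ v → a ℤ.* (+ deg w v) ℤ.+ b ≡ + sdeg w v) →
    (σ : Permutation′ (suc (suc (suc k)))) →
    CycleLabelling (suc (suc (suc k))) w σ →
    w (σ ⟨$⟩ʳ zero) (σ ⟨$⟩ʳ fromℕ (suc (suc k))) ≡ 2 →
    w (σ ⟨$⟩ʳ zero) (σ ⟨$⟩ʳ suc zero) ≡ 1 →
    w (σ ⟨$⟩ʳ fromℕ (suc (suc k))) (σ ⟨$⟩ʳ inject₁ (fromℕ (suc k))) ≡ 1 →
    ∃[ t ] (1 ≤ t × (IsoU1 (suc (suc (suc k))) w t ⊎ IsoU2 (suc (suc (suc k))) w t))
theorem3p5 R acf k w H two a b relation σ cyc w-u₁v₁ w-u₁u₂ w-v₁v₂ =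
  case BalancedSeq-classification a b weight-1or2 (weight-balanced a b relation)
         (weight-v₂v₁ w-v₁v₂) (weight-v₁u₁ w-u₁v₁) (weight-u₁u₂ w-u₁u₂) of λ where
    (inj₁ alternating) →
      ⊥-elim (regular⇒¬ExactlyTwoMain R w 3 (alternating⇒regular alternating) (IsACF₀.inverse acf) two)
    (inj₂ (inj₁ u1)) → map₂ (map₂ inj₁) (ringIso 1 3 (u1Weights-period n (weights-period u1Weights u1))
                                           λ i → trans (u1 (suc i)) (sym (ringMult-u1Weights i)))
    (inj₂ (inj₂ u2)) → map₂ (map₂ inj₂) (ringIso 1 2 (u2Weights-period n (weights-period u2Weights u2))
                                           λ i → trans (u2 (suc i)) (sym (ringMult-u2Weights i)))
  where open CycleLabelled k w H σ cyc
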